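{- Let $G$ be a connected block graph and let $S$ be the set of simplicial vertices of $G$. Then $S$ is a gp-set of $G$, and hence $\mathrm{gp}(G)=|S|$.
   Context: A block of a graph is a maximal connected subgraph without a cut-vertex; a block graph is a graph each of whose blocks is complete. A vertex is simplicial if its neighbours induce a complete subgraph. A set of vertices is a general position set if no three distinct vertices of it lie on a common geodesic (shortest path) of $G$; $\mathrm{gp}(G)$ is the maximum cardinality of a general position set and a general position set of that cardinality is a gp-set. -}

module Defs where

open import Data.Nat using (ℕ; zero; suc; _≤_)
open import Data.Bool using (Bool; true; false)
open import Data.Fin using (Fin)
open import Data.Fin.Subset using (Subset; _∈_; _∉_; _⊆_; ∣_∣)
open import Data.List using (List; []; _∷_)
open import Data.List.Relation.Unary.All using (All)
import Data.List.Membership.Propositional as LM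
open import Data.Product using (Σ; ∃; ∃-syntax; _×_; _,_)
open import Relation.Binary.PropositionalEquality using (_≡_; _≢_)
open import Relation.Nullary using (¬_)

record Graph (n : ℕ) : Set where
  field
    adj    : Fin n → Fin n → Bool
    sym    : ∀ u v → adj u v ≡ adj v u
    irrefl : ∀ v → adj v v ≡ false

module _ {n : ℕ} (G : Graph n) where
  open Graph G

  Adj : Fin n → Fin n → Set
  Adj u v = adj u v ≡ true

  data Walk : Fin n → Fin n → Set where
    here : ∀ {u} → Walk u u
    step : ∀ {u w v} → Adj u w → Walk w v → Walk u v

  length : ∀ {u v} → Walk u v → ℕ
  length here       = zero
  length (step _ p) = suc (length p)

  vertices : ∀ {u v} → Walk u v → List (Fin n)
  vertices {u} here       = u ∷ []
  vertices {u} (step _ p) = u ∷ vertices p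

  OnWalk : ∀ {u v} → Fin n → Walk u v → Set
  OnWalk x p = x LM.∈ vertices p

  Connected : Set
  Connected = ∀ u v → Walk u v

  Geodesic : ∀ {u v} → Walk u v → Set
  Geodesic {u} {v} p = ∀ (q : Walk u v) → length p ≤ length q

  OnCommonGeodesic : Fin n → Fin n → Fin n → Set
  OnCommonGeodesic x y z =
    ∃[ u ] ∃[ v ] Σ (Walk u v) λ p →
      Geodesic p × OnWalk x p × OnWalk y p × OnWalk z p

  IsGeneralPosition : Subset n → Set
  IsGeneralPosition S = ∀ x y z → x ∈ S → y ∈ S → z ∈ S →
    x ≢ y → y ≢ z → x ≢ z → ¬ OnCommonGeodesic x y z

  IsGpSet : Subset n → Set
  IsGpSet S = IsGeneralPosition S × (∀ T → IsGeneralPosition T → ∣ T ∣ ≤ ∣ S ∣)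

  IsGpNumber : ℕ → Set
  IsGpNumber k = (∃[ S ] (IsGeneralPosition S × ∣ S ∣ ≡ k))
               × (∀ T → IsGeneralPosition T → ∣ T ∣ ≤ k)

  Simplicial : Fin n → Set
  Simplicial v = ∀ a b → Adj v a → Adj v b → a ≢ b → Adj a b

  -- induced subgraphs G[B] for vertex sets B
  WalkIn : Subset n → ∀ {u v} → Walk u v → Set
  WalkIn B p = All (_∈ B) (vertices p)

  ConnectedIn : Subset n → Set
  ConnectedIn B = ∀ u v → u ∈ B → v ∈ B → Σ (Walk u v) (WalkIn B)

  IsCutVertexIn : Subset n → Fin n → Set
  IsCutVertexIn B c = c ∈ B × ∃[ u ] ∃[ v ]
    (u ∈ B × v ∈ B × u ≢ c × v ≢ c ×
     ((p : Walk u v) → ¬ (WalkIn B p × ¬ OnWalk c p)))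

  ConnectedNoCut : Subset n → Set
  ConnectedNoCut B = (∃[ v ] v ∈ B) × ConnectedIn B × (∀ c → ¬ IsCutVertexIn B c)

  IsBlock : Subset n → Set
  IsBlock B = ConnectedNoCut B × (∀ B′ → B ⊆ B′ → ConnectedNoCut B′ → B′ ⊆ B)

  CompleteOn : Subset n → Set
  CompleteOn B = ∀ u v → u ∈ B → v ∈ B → u ≢ v → Adj u v

  IsBlockGraph : Set
  IsBlockGraph = ∀ B → IsBlock B → CompleteOn B

-- Simplicial vertices are never inner vertices of a geodesic, so the simplicial vertices are
-- in general position (in any graph).
--
-- Conversely let T be in general position. A non-simplicial x ∈ T has non-adjacent neighbours
-- a and b, and in a block graph x separates a from b: a shortest a–b walk avoiding x spans,
-- together with x, a connected set without cut-vertex, which lies in a complete block.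
-- If vertices of T − x were reachable from both a and b avoiding x, a geodesic between them
-- would either avoid x (joining a to b) or pass through x (contradicting general position).
-- So for one of them, say a, take the vertex s farthest from x among those reachable from a
-- avoiding x: its neighbours are no farther from x, so geodesics from x to them avoid s, which
-- forces s to be simplicial. Moreover s ∉ T and x separates s from T − x. Sending x to itself
-- when x is simplicial and to such an s otherwise is injective, hence |T| ≤ |S|.
--
-- Shortest walks, farthest vertices and blocks are obtained under double negation; this is
-- harmless since all conclusions drawn from them are decidable.

module Submission where

open import Defs
open import Data.Bool using (true)
import Data.Bool as Bool
open import Data.Empty using (⊥; ⊥-elim)
open import Data.Fin using (Fin; zero; suc; _≟_)
open import Data.Fin.Subset
  using (Subset; _∈_; _∉_; _⊆_; _⊂_; _⊃_; ∣_∣; ⁅_⁆; _∪_; _-_; inside; outside)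
  renaming (⊥ to ∅)
open import Data.Fin.Subset.Induction using (⊃-wellFounded; ⊂-wellFounded)
open import Data.Fin.Subset.Properties
  using (_∈?_; ∉⊥; x∈⁅x⁆; x∈⁅y⁆⇒x≡y; x∈p∪q⁺; x∈p∪q⁻; p─⊥≡p; nonempty?; Empty-unique; ∣⊥∣≡0;
         x∈p⇒∣p-x∣<∣p∣; x∈p⇒p-x⊂p; p─q⊆p; x∈p∧x≢y⇒x∈p-y)
open import Data.List using (List; []; _∷_)
import Data.List.Membership.DecPropositional as LDec
import Data.List.Membership.Propositional as L
open import Data.List.Relation.Unary.All using (tabulate)
open import Data.List.Relation.Unary.Any using (here; there)
open import Data.Nat using (ℕ; zero; suc; _+_; _≤_; _<_; z≤n; s≤s; _≤?_)
open import Data.Nat.Induction using (<-wellFounded)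
open import Data.Nat.Properties
  using (≤-refl; ≤-trans; ≤-reflexive; <-irrefl; <-trans; <-≤-trans; ≤-<-trans; ≮⇒≥; <⇒≤; n<1+n;
         m<m+n; m<n+m; +-mono-<; +-monoʳ-≤; +-monoˡ-≤; +-monoˡ-<; module ≤-Reasoning)
open import Data.Product using (∃; ∃₂; _×_; _,_; proj₁; proj₂)
open import Data.Sum using (_⊎_; inj₁; inj₂; [_,_]; map₁)
open import Data.Unit using (⊤; tt)
open import Data.Vec.Base using (_∷_; here; there)
open import Effect.Monad using (RawMonad)
open import Function using (_∘_; _on_)
open import Function.Bundles using (_⇔_; Equivalence)
open import Induction.WellFounded using (Acc; acc)
open import Level using (0ℓ)
import Relation.Binary.Construct.On as On
open import Relation.Binary.PropositionalEquality using (_≡_; _≢_; refl; sym; trans; cong; subst; subst₂; ≢-sym)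
open import Relation.Nullary using (¬_; Dec; yes; no)
open import Relation.Nullary.Decidable using (decidable-stable; ¬¬-excluded-middle)
open import Relation.Nullary.Negation using (¬¬-Monad)

open RawMonad (¬¬-Monad {0ℓ}) using (pure; _>>=_)

¬¬-dec : (A : Set) → ¬ ¬ Dec A
¬¬-dec A = ¬¬-excluded-middle

¬¬-→ : {A B : Set} → (A → ¬ ¬ B) → ¬ ¬ (A → B)
¬¬-→ f ¬[A→B] = ¬[A→B] λ a → ⊥-elim (f a λ b → ¬[A→B] λ _ → b)

¬¬-Π : ∀ {n} {B : Fin n → Set} → (∀ x → ¬ ¬ B x) → ¬ ¬ (∀ x → B x)
¬¬-Π {zero}      _ = pure λ ()
¬¬-Π {suc n} {B} h = do
  b₀ ← h zero
  bₛ ← ¬¬-Π {B = B ∘ suc} (h ∘ suc)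
  pure λ { zero → b₀ ; (suc x) → bₛ x }

¬¬-maximum : ∀ {n} (R : Fin n → Set) (d : Fin n → ℕ) → ∃ R →
             ¬ ¬ (∃ λ s → R s × ∀ {r} → R r → d r ≤ d s)
¬¬-maximum {suc n} R d (x , Rx) = do
  yes (r , Rsr) ← ¬¬-dec (∃ (R ∘ suc))
    where no ¬R∘suc → pure (zero , R-zero x Rx ¬R∘suc , λ {r} → only-zero ¬R∘suc {r})
  s , Rss , max ← ¬¬-maximum (R ∘ suc) (d ∘ suc) (r , Rsr)
  yes (R₀ , d-s<d₀) ← ¬¬-dec (R zero × d (suc s) < d zero)
    where no ¬zero-better → pure (suc s , Rss , λ { {zero} R₀ → ≮⇒≥ (¬zero-better ∘ (R₀ ,_)) ; {suc r} → max })
  pure (zero , R₀ , λ { {zero} _ → ≤-refl ; {suc r} Rsr → <⇒≤ (≤-<-trans (max Rsr) d-s<d₀) })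
  where
  R-zero : ∀ x → R x → ¬ ∃ (R ∘ suc) → R zero
  R-zero zero    Rx _       = Rx
  R-zero (suc x) Rx ¬R∘suc = ⊥-elim (¬R∘suc (x , Rx))
  only-zero : ¬ ∃ (R ∘ suc) → ∀ {r} → R r → d r ≤ d zero
  only-zero _      {zero}  _   = ≤-refl
  only-zero ¬R∘suc {suc r} Rsr = ⊥-elim (¬R∘suc (r , Rsr))

x∉p-x : ∀ {n} (p : Subset n) (x : Fin n) → x ∉ p - x
x∉p-x (inside  ∷ p) zero    ()
x∉p-x (outside ∷ p) zero    ()
x∉p-x (_       ∷ p) (suc x) (there x∈p-x) = x∉p-x p x x∈p-x

∣p∣≤1+∣p-x∣ : ∀ {n} {p : Subset n} {x : Fin n} → x ∈ p → ∣ p ∣ ≤ suc ∣ p - x ∣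
∣p∣≤1+∣p-x∣ {p = inside  ∷ p} {zero}  here       = s≤s (≤-reflexive (cong ∣_∣ (sym (p─⊥≡p p))))
∣p∣≤1+∣p-x∣ {p = inside  ∷ p} {suc x} (there x∈p) = s≤s (∣p∣≤1+∣p-x∣ x∈p)
∣p∣≤1+∣p-x∣ {p = outside ∷ p} {suc x} (there x∈p) = ∣p∣≤1+∣p-x∣ x∈p

record SubsetInjection {n : ℕ} (T S : Subset n) : Set where
  field
    to        : ∀ {x} → x ∈ T → Fin n
    to∈       : ∀ {x} (x∈T : x ∈ T) → to x∈T ∈ S
    injective : ∀ {x y} (x∈T : x ∈ T) (y∈T : y ∈ T) → to x∈T ≡ to y∈T → x ≡ y

∣∣-mono-injection : ∀ {n} {T S : Subset n} → SubsetInjection T S → ∣ T ∣ ≤ ∣ S ∣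
∣∣-mono-injection {T = T} = go (⊂-wellFounded T)
  where
  go : ∀ {n} {T S : Subset n} → Acc _⊂_ T → SubsetInjection T S → ∣ T ∣ ≤ ∣ S ∣
  go {n} {T} {S} (acc rs) ι with nonempty? T
  ... | no T-empty = ≤-trans (≤-reflexive (trans (cong ∣_∣ (Empty-unique T-empty)) (∣⊥∣≡0 n))) z≤n
  ... | yes (x , x∈T) = ≤-trans (∣p∣≤1+∣p-x∣ x∈T) (<-≤-trans (s≤s smaller) (x∈p⇒∣p-x∣<∣p∣ (to∈ x∈T)))
    where
    open SubsetInjection ι
    shrink : ∀ {y} → y ∈ T - x → y ∈ T
    shrink = p─q⊆p T ⁅ x ⁆
    restricted : SubsetInjection (T - x) (S - to x∈T)
    restricted = record
      { to        = to ∘ shrink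
      ; to∈       = λ y∈T-x → x∈p∧x≢y⇒x∈p-y (to∈ (shrink y∈T-x))
                      (λ ty≡tx → x∉p-x T x (subst (_∈ T - x) (injective _ x∈T ty≡tx) y∈T-x))
      ; injective = λ y∈ z∈ → injective (shrink y∈) (shrink z∈)
      }
    smaller : ∣ T - x ∣ ≤ ∣ S - to x∈T ∣
    smaller = go (rs (x∈p⇒p-x⊂p x∈T)) restricted

fromList : ∀ {n} → List (Fin n) → Subset n
fromList []       = ∅
fromList (x ∷ xs) = ⁅ x ⁆ ∪ fromList xs

∈-fromList⁺ : ∀ {n} {x : Fin n} xs → x L.∈ xs → x ∈ fromList xs
∈-fromList⁺ (y ∷ _)  (here refl) = x∈p∪q⁺ (inj₁ (x∈⁅x⁆ y))
∈-fromList⁺ (_ ∷ xs) (there x∈)  = x∈p∪q⁺ (inj₂ (∈-fromList⁺ xs x∈))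

∈-fromList⁻ : ∀ {n} {x : Fin n} xs → x ∈ fromList xs → x L.∈ xs
∈-fromList⁻ []       x∈ = ⊥-elim (∉⊥ x∈)
∈-fromList⁻ (y ∷ xs) x∈ with x∈p∪q⁻ ⁅ y ⁆ (fromList xs) x∈
... | inj₁ x∈⁅y⁆ = here (x∈⁅y⁆⇒x≡y y x∈⁅y⁆)
... | inj₂ x∈xs  = there (∈-fromList⁻ xs x∈xs)

one-of-three-avoids : ∀ {n} {x y z : Fin n} → x ≢ y → y ≢ z → x ≢ z → (u v : Fin n) →
                      (x ≢ u × x ≢ v) ⊎ (y ≢ u × y ≢ v) ⊎ (z ≢ u × z ≢ v)
one-of-three-avoids {x = x} {y} x≢y y≢z x≢z u v with x ≟ u | x ≟ v | y ≟ u | y ≟ v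
... | no x≢u   | no x≢v   | _        | _        = inj₁ (x≢u , x≢v)
... | _        | _        | no y≢u   | no y≢v   = inj₂ (inj₁ (y≢u , y≢v))
... | yes refl | _        | yes refl | _        = ⊥-elim (x≢y refl)
... | _        | yes refl | _        | yes refl = ⊥-elim (x≢y refl)
... | yes refl | _        | _        | yes refl = inj₂ (inj₂ (≢-sym x≢z , ≢-sym y≢z))
... | _        | yes refl | yes refl | _        = inj₂ (inj₂ (≢-sym y≢z , ≢-sym x≢z))

module _ {n : ℕ} (G : Graph n) where
  open Graph G using (adj; irrefl)

  infix  4 _∈ᵂ_ _∉ᵂ_ _∈ᵂ?_ _⊑_
  infixr 5 _++_

  _∈ᵂ_ : ∀ {u v} → Fin n → Walk G u v → Set
  x ∈ᵂ p = OnWalk G x p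

  _∉ᵂ_ : ∀ {u v} → Fin n → Walk G u v → Set
  x ∉ᵂ p = ¬ x ∈ᵂ p

  AllOn : ∀ {u v} → (Fin n → Set) → Walk G u v → Set
  AllOn P p = ∀ {x} → x ∈ᵂ p → P x

  _⊑_ : ∀ {u v u′ v′} → Walk G u v → Walk G u′ v′ → Set
  p ⊑ q = AllOn (_∈ᵂ q) p

  _∈ᵂ?_ : ∀ {u v} (x : Fin n) (p : Walk G u v) → Dec (x ∈ᵂ p)
  x ∈ᵂ? p = LDec._∈?_ _≟_ x (vertices G p)

  AllOn-here : ∀ {P : Fin n → Set} {u} → P u → AllOn P (here {u = u})
  AllOn-here Pu (here refl) = Pu

  Adj-sym : ∀ {u v} → Adj G u v → Adj G v u
  Adj-sym {u} {v} u~v = trans (Graph.sym G v u) u~v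

  Adj⇒≢ : ∀ {u v} → Adj G u v → u ≢ v
  Adj⇒≢ {u} u~u refl with trans (sym u~u) (irrefl u)
  ... | ()

  edge : ∀ {u v} → Adj G u v → Walk G u v
  edge u~v = step u~v here

  start∈ᵂ : ∀ {u v} (p : Walk G u v) → u ∈ᵂ p
  start∈ᵂ here       = here refl
  start∈ᵂ (step _ _) = here refl

  end∈ᵂ : ∀ {u v} (p : Walk G u v) → v ∈ᵂ p
  end∈ᵂ here       = here refl
  end∈ᵂ (step _ p) = there (end∈ᵂ p)

  _++_ : ∀ {u v w} → Walk G u v → Walk G v w → Walk G u w
  here     ++ q = q
  step e p ++ q = step e (p ++ q)

  length-++ : ∀ {u v w} (p : Walk G u v) (q : Walk G v w) → length G (p ++ q) ≡ length G p + length G q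
  length-++ here       q = refl
  length-++ (step e p) q = cong suc (length-++ p q)

  ∈-++⁻ : ∀ {u v w x} (p : Walk G u v) (q : Walk G v w) → x ∈ᵂ p ++ q → x ∈ᵂ p ⊎ x ∈ᵂ q
  ∈-++⁻ here       q x∈q         = inj₂ x∈q
  ∈-++⁻ (step e p) q (here refl) = inj₁ (here refl)
  ∈-++⁻ (step e p) q (there x∈)  = map₁ there (∈-++⁻ p q x∈)

  ⊑-++ˡ : ∀ {u v w} (p : Walk G u v) (q : Walk G v w) → p ⊑ p ++ q
  ⊑-++ˡ here       q (here refl) = start∈ᵂ q
  ⊑-++ˡ (step e p) q (here refl) = here refl
  ⊑-++ˡ (step e p) q (there x∈p) = there (⊑-++ˡ p q x∈p)

  ⊑-++ʳ : ∀ {u v w} (p : Walk G u v) (q : Walk G v w) → q ⊑ p ++ q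
  ⊑-++ʳ here       q x∈q = x∈q
  ⊑-++ʳ (step e p) q x∈q = there (⊑-++ʳ p q x∈q)

  AllOn-++ : ∀ {P : Fin n → Set} {u v w} {p : Walk G u v} {q : Walk G v w} →
             AllOn P p → AllOn P q → AllOn P (p ++ q)
  AllOn-++ {p = p} {q} Pp Pq = [ Pp , Pq ] ∘ ∈-++⁻ p q

  AllOn-edge : ∀ {P : Fin n → Set} {u v} (u~v : Adj G u v) → P u → P v → AllOn P (edge u~v)
  AllOn-edge _ Pu Pv (here refl)         = Pu
  AllOn-edge _ Pu Pv (there (here refl)) = Pv

  ∉-++ : ∀ {u v w c} {p : Walk G u v} {q : Walk G v w} → c ∉ᵂ p → c ∉ᵂ q → c ∉ᵂ p ++ q
  ∉-++ {p = p} {q} c∉p c∉q = [ c∉p , c∉q ] ∘ ∈-++⁻ p q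

  reverse : ∀ {u v} → Walk G u v → Walk G v u
  reverse here       = here
  reverse (step e p) = reverse p ++ edge (Adj-sym e)

  reverse⊑ : ∀ {u v} (p : Walk G u v) → reverse p ⊑ p
  reverse⊑ here       x∈ = x∈
  reverse⊑ (step e p) x∈ with ∈-++⁻ (reverse p) (edge (Adj-sym e)) x∈
  ... | inj₁ x∈rev-p              = there (reverse⊑ p x∈rev-p)
  ... | inj₂ (here refl)          = there (start∈ᵂ p)
  ... | inj₂ (there (here refl))  = here refl

  AllOn-reverse : ∀ {P : Fin n → Set} {u v} {p : Walk G u v} → AllOn P p → AllOn P (reverse p)
  AllOn-reverse {p = p} Pp = Pp ∘ reverse⊑ p

  ∉-reverse : ∀ {u v c} {p : Walk G u v} → c ∉ᵂ p → c ∉ᵂ reverse p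
  ∉-reverse {p = p} c∉p = c∉p ∘ reverse⊑ p

  split : ∀ {u v z} (p : Walk G u v) → z ∈ᵂ p → ∃₂ λ (q : Walk G u z) (r : Walk G z v) → q ++ r ≡ p
  split here       (here refl) = here , here , refl
  split (step e p) (here refl) = here , step e p , refl
  split (step e p) (there z∈p) with split p z∈p
  ... | q , r , refl = step e q , r , refl

  0<length : ∀ {u v} → u ≢ v → (p : Walk G u v) → 0 < length G p
  0<length u≢u here       = ⊥-elim (u≢u refl)
  0<length _   (step _ _) = s≤s z≤n

  prefix : ∀ {u v z} (p : Walk G u v) → z ∈ᵂ p → z ≢ v →
           ∃ λ (q : Walk G u z) → length G q < length G p × q ⊑ p
  prefix p z∈p z≢v with split p z∈p
  ... | q , r , refl =
    q , subst (length G q <_) (sym (length-++ q r)) (m<m+n _ (0<length z≢v r)) , ⊑-++ˡ q r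

  suffix : ∀ {u v z} (p : Walk G u v) → z ∈ᵂ p → u ≢ z →
           ∃ λ (r : Walk G z v) → length G r < length G p × r ⊑ p
  suffix p z∈p u≢z with split p z∈p
  ... | q , r , refl =
    r , subst (length G r <_) (sym (length-++ q r)) (m<n+m _ (0<length u≢z q)) , ⊑-++ʳ q r

  shortcut : ∀ {u v w c} (q : Walk G u w) (r : Walk G w v) → c ∈ᵂ q → c ∈ᵂ r → c ≢ w →
             ∃ λ (p : Walk G u v) → length G p < length G (q ++ r) × p ⊑ q ++ r
  shortcut q r c∈q c∈r c≢w with prefix q c∈q c≢w | suffix r c∈r (≢-sym c≢w)
  ... | q₁ , q₁<q , q₁⊑q | r₂ , r₂<r , r₂⊑r =
    q₁ ++ r₂ ,
    subst₂ _<_ (sym (length-++ q₁ r₂)) (sym (length-++ q r)) (+-mono-< q₁<q r₂<r) ,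
    AllOn-++ (⊑-++ˡ q r ∘ q₁⊑q) (⊑-++ʳ q r ∘ r₂⊑r)

  Shortest : ∀ {u v} → (Walk G u v → Set) → Walk G u v → Set
  Shortest Q p = Q p × ∀ q → Q q → length G p ≤ length G q

  ¬¬-shortest : ∀ {u v} (Q : Walk G u v → Set) {p : Walk G u v} → Q p → ¬ ¬ ∃ (Shortest Q)
  ¬¬-shortest Q {p} Qp = go (On.wellFounded (length G) <-wellFounded p) Qp
    where
    go : ∀ {p} → Acc (_<_ on length G) p → Q p → ¬ ¬ ∃ (Shortest Q)
    go {p} (acc shorter-acc) Qp = do
      yes (q , Qq , q<p) ← ¬¬-dec (∃ λ q → Q q × length G q < length G p)
        where no ¬shorter → pure (p , Qp , λ q Qq → ≮⇒≥ (¬shorter ∘ (q ,_) ∘ (Qq ,_)))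
      go (shorter-acc q<p) Qq

  ¬¬-geodesic : ∀ {u v} → Walk G u v → ¬ ¬ ∃ (Geodesic G {u} {v})
  ¬¬-geodesic p = do
    g , _ , minimal ← ¬¬-shortest (λ _ → ⊤) {p} tt
    pure (g , λ q → minimal q tt)

  unsnoc : ∀ {u m w} (e : Adj G u m) (q : Walk G m w) →
           ∃₂ λ a (q′ : Walk G u a) → Adj G a w × length G (step e q) ≡ suc (length G q′)
  unsnoc e here         = _ , here , e , refl
  unsnoc e (step e′ q) with unsnoc e′ q
  ... | a , q′ , a~w , len-eq = a , step e q′ , a~w , cong suc len-eq

  simplicial-not-inner : ∀ {u v w} (p : Walk G u v) → Geodesic G p → Simplicial G w →
                         w ∈ᵂ p → w ≢ u → w ≢ v → ⊥
  simplicial-not-inner p geodesic simplicial w∈p w≢u w≢v with split p w∈p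
  ... | here     , _ , refl = w≢u refl
  ... | step _ _ , here , refl = w≢v refl
  ... | step u~m q , step {w = b} w~b r , refl with unsnoc u~m q
  ... | a , q′ , a~w , len-eq =
    <-irrefl refl (≤-<-trans (geodesic (q′ ++ proj₁ bypass ++ r)) shorter)
    where
    -- the neighbours a, b of w on p are equal or, w being simplicial, adjacent
    bypass : ∃ λ (p : Walk G a b) → length G p ≤ 1
    bypass with a ≟ b
    ... | yes refl = here , z≤n
    ... | no a≢b   = edge (simplicial a b (Adj-sym a~w) w~b a≢b) , ≤-refl
    shorter : length G (q′ ++ proj₁ bypass ++ r) < length G (step u~m q ++ step w~b r)
    shorter = begin-strict
      length G (q′ ++ proj₁ bypass ++ r)
        ≡⟨ trans (length-++ q′ _) (cong (length G q′ +_) (length-++ (proj₁ bypass) r)) ⟩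
      length G q′ + (length G (proj₁ bypass) + length G r)
        ≤⟨ +-monoʳ-≤ (length G q′) (+-monoˡ-≤ (length G r) (proj₂ bypass)) ⟩
      length G q′ + suc (length G r)
        <⟨ +-monoˡ-< (suc (length G r)) (n<1+n (length G q′)) ⟩
      suc (length G q′) + suc (length G r)
        ≡⟨ cong (_+ suc (length G r)) (sym len-eq) ⟩
      length G (step u~m q) + length G (step w~b r)
        ≡⟨ sym (length-++ (step u~m q) (step w~b r)) ⟩
      length G (step u~m q ++ step w~b r) ∎
      where open ≤-Reasoning

  simplicial-generalPosition : (S : Subset n) → (∀ {v} → v ∈ S → Simplicial G v) → IsGeneralPosition G S
  simplicial-generalPosition S simplicial x y z x∈S y∈S z∈S x≢y y≢z x≢z (u , v , p , geodesic , x∈p , y∈p , z∈p)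
    with one-of-three-avoids x≢y y≢z x≢z u v
  ... | inj₁ (x≢u , x≢v)        = simplicial-not-inner p geodesic (simplicial x∈S) x∈p x≢u x≢v
  ... | inj₂ (inj₁ (y≢u , y≢v)) = simplicial-not-inner p geodesic (simplicial y∈S) y∈p y≢u y≢v
  ... | inj₂ (inj₂ (z≢u , z≢v)) = simplicial-not-inner p geodesic (simplicial z∈S) z∈p z≢u z≢v

  ¬¬-nonadjacent-neighbours : ∀ {x} → ¬ Simplicial G x →
                              ¬ ¬ ∃₂ λ a b → Adj G x a × Adj G x b × a ≢ b × ¬ Adj G a b
  ¬¬-nonadjacent-neighbours ¬simplicial ¬∃ = ¬simplicial λ a b x~a x~b a≢b →
    decidable-stable (adj a b Bool.≟ true) λ a≁b → ¬∃ (a , b , x~a , x~b , a≢b , a≁b)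

  AllOn⇒WalkIn : ∀ {B u v} {p : Walk G u v} → AllOn (_∈ B) p → WalkIn G B p
  AllOn⇒WalkIn = tabulate

  _∖_ : Subset n → Fin n → Fin n → Set
  (C ∖ c) x = x ∈ C × x ≢ c

  WalkConnected : (Fin n → Set) → Set
  WalkConnected X = ∀ {u v} → X u → X v → ∃ λ (p : Walk G u v) → AllOn X p

  walkConnected-via-hub : ∀ {X : Fin n → Set} {h} →
                          (∀ {w} → X w → ∃ λ (p : Walk G w h) → AllOn X p) → WalkConnected X
  walkConnected-via-hub to-hub Xu Xv with to-hub Xu | to-hub Xv
  ... | p , Xp | q , Xq = p ++ reverse q , AllOn-++ Xp (AllOn-reverse Xq)

  ¬cutVertex : ∀ {C c} → WalkConnected (C ∖ c) → ¬ IsCutVertexIn G C c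
  ¬cutVertex C∖c-connected (_ , u , v , u∈C , v∈C , u≢c , v≢c , separated)
    with C∖c-connected (u∈C , u≢c) (v∈C , v≢c)
  ... | p , p⊆C∖c = separated p (AllOn⇒WalkIn (proj₁ ∘ p⊆C∖c) , λ c∈p → proj₂ (p⊆C∖c c∈p) refl)

  maximal⇒block : ∀ {C} → ConnectedNoCut G C → ¬ (∃ λ B → C ⊂ B × ConnectedNoCut G B) → IsBlock G C
  maximal⇒block {C} C-cnc ¬larger = C-cnc , maximal
    where
    maximal : ∀ B → C ⊆ B → ConnectedNoCut G B → B ⊆ C
    maximal B C⊆B B-cnc {x} x∈B with x ∈? C
    ... | yes x∈C = x∈C
    ... | no x∉C  = ⊥-elim (¬larger (B , (C⊆B , x , x∈B , x∉C) , B-cnc))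

  ¬¬-block-⊇ : ∀ {C} → ConnectedNoCut G C → ¬ ¬ ∃ λ B → IsBlock G B × C ⊆ B
  ¬¬-block-⊇ {C₀} = go (⊃-wellFounded C₀)
    where
    go : ∀ {C} → Acc _⊃_ C → ConnectedNoCut G C → ¬ ¬ ∃ λ B → IsBlock G B × C ⊆ B
    go {C} (acc larger-acc) C-cnc = do
      yes (B , C⊂B , B-cnc) ← ¬¬-dec (∃ λ B → C ⊂ B × ConnectedNoCut G B)
        where no ¬larger → pure (C , maximal⇒block C-cnc ¬larger , λ {x} x∈C → x∈C)
      B′ , B′-block , B⊆B′ ← go (larger-acc C⊂B) B-cnc
      pure (B′ , B′-block , λ {x} x∈C → B⊆B′ (proj₁ C⊂B x∈C))

  -- s closes a shortest a–b walk P avoiding s into a cycle, whose vertex set has no cut-vertex.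
  module Cycle {s a b} (s~a : Adj G s a) (s~b : Adj G s b)
               (P : Walk G a b) (P-shortest : Shortest (s ∉ᵂ_) P) where

    C : Subset n
    C = fromList (s ∷ vertices G P)

    s∈C : s ∈ C
    s∈C = ∈-fromList⁺ (s ∷ vertices G P) (here refl)

    P⊆C : AllOn (_∈ C) P
    P⊆C = ∈-fromList⁺ (s ∷ vertices G P) ∘ there

    ∈C⁻ : ∀ {x} → x ∈ C → x ≡ s ⊎ x ∈ᵂ P
    ∈C⁻ x∈C with ∈-fromList⁻ (s ∷ vertices G P) x∈C
    ... | here x≡s = inj₁ x≡s
    ... | there x∈P = inj₂ x∈P

    part-avoiding : ∀ {c u v} (p : Walk G u v) → p ⊑ P → c ∉ᵂ p → AllOn (C ∖ c) p
    part-avoiding p p⊑P c∉p x∈p = P⊆C (p⊑P x∈p) , λ { refl → c∉p x∈p }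

    via-a : ∀ {X : Fin n → Set} {w} (q : Walk G a w) → AllOn X q → X s →
            ∃ λ (p : Walk G w s) → AllOn X p
    via-a q Xq Xs = reverse q ++ edge (Adj-sym s~a) ,
                    AllOn-++ (AllOn-reverse Xq) (AllOn-edge (Adj-sym s~a) (Xq (start∈ᵂ q)) Xs)

    via-b : ∀ {X : Fin n → Set} {w} (r : Walk G w b) → AllOn X r → X s →
            ∃ λ (p : Walk G w s) → AllOn X p
    via-b r Xr Xs = r ++ edge (Adj-sym s~b) , AllOn-++ Xr (AllOn-edge (Adj-sym s~b) (Xr (end∈ᵂ r)) Xs)

    to-s : ∀ {w} → w ∈ C → ∃ λ (p : Walk G w s) → AllOn (_∈ C) p
    to-s w∈C with ∈C⁻ w∈C
    ... | inj₁ refl = here , AllOn-here s∈C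
    ... | inj₂ w∈P with split P w∈P
    ... | q , r , refl = via-a q (P⊆C ∘ ⊑-++ˡ q r) s∈C

    -- c cannot lie on both sides of w, since P is shortest
    to-s-avoiding : ∀ {c} → c ≢ s → ∀ {w} → (C ∖ c) w → ∃ λ (p : Walk G w s) → AllOn (C ∖ c) p
    to-s-avoiding {c} c≢s (w∈C , w≢c) with ∈C⁻ w∈C
    ... | inj₁ refl = here , AllOn-here {P = C ∖ c} (s∈C , ≢-sym c≢s)
    ... | inj₂ w∈P with split P w∈P
    ... | q , r , refl with c ∈ᵂ? q | c ∈ᵂ? r
    ... | no c∉q | _      = via-a q (part-avoiding q (⊑-++ˡ q r) c∉q) (s∈C , ≢-sym c≢s)
    ... | yes _  | no c∉r = via-b r (part-avoiding r (⊑-++ʳ q r) c∉r) (s∈C , ≢-sym c≢s)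
    ... | yes c∈q | yes c∈r with shortcut q r c∈q c∈r (≢-sym w≢c)
    ... | p , p<P , p⊑P = ⊥-elim (<-irrefl refl (<-≤-trans p<P (proj₂ P-shortest p (proj₁ P-shortest ∘ p⊑P))))

    to-a-avoiding-s : ∀ {w} → (C ∖ s) w → ∃ λ (p : Walk G w a) → AllOn (C ∖ s) p
    to-a-avoiding-s (w∈C , w≢s) with ∈C⁻ w∈C
    ... | inj₁ w≡s = ⊥-elim (w≢s w≡s)
    ... | inj₂ w∈P with split P w∈P
    ... | q , r , refl = reverse q , AllOn-reverse (part-avoiding q (⊑-++ˡ q r) (proj₁ P-shortest ∘ ⊑-++ˡ q r))

    connectedNoCut : ConnectedNoCut G C
    connectedNoCut = (s , s∈C) , connectedIn , noCut
      where
      connectedIn : ConnectedIn G C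
      connectedIn u v u∈C v∈C with walkConnected-via-hub to-s u∈C v∈C
      ... | p , p⊆C = p , AllOn⇒WalkIn p⊆C
      noCut : ∀ c → ¬ IsCutVertexIn G C c
      noCut c with c ≟ s
      ... | yes refl = ¬cutVertex (walkConnected-via-hub to-a-avoiding-s)
      ... | no c≢s   = ¬cutVertex (walkConnected-via-hub (to-s-avoiding c≢s))

  module _ (blockGraph : IsBlockGraph G) where

    common-neighbour-separates : ∀ {s a b} → Adj G s a → Adj G s b → a ≢ b → ¬ Adj G a b →
                                 (p : Walk G a b) → s ∈ᵂ p
    common-neighbour-separates {s} {a} {b} s~a s~b a≢b a≁b p = decidable-stable (s ∈ᵂ? p) λ s∉p →
      ¬¬-shortest (s ∉ᵂ_) s∉p λ (P , P-shortest) → block-through P P-shortest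
      where
      block-through : (P : Walk G a b) → Shortest (s ∉ᵂ_) P → ⊥
      block-through P P-shortest = ¬¬-block-⊇ connectedNoCut λ (B , B-block , C⊆B) →
        a≁b (blockGraph B B-block a b (C⊆B (P⊆C (start∈ᵂ P))) (C⊆B (P⊆C (end∈ᵂ P))) a≢b)
        where open Cycle s~a s~b P P-shortest

    module Representatives (connected : Connected G)
                           (S : Subset n) (simplicial⇒∈S : ∀ {v} → Simplicial G v → v ∈ S)
                           (T : Subset n) (T-gp : IsGeneralPosition G T) where

      ShieldedBy : Fin n → Fin n → Set
      ShieldedBy x y = ∀ {t} → t ∈ T → t ≢ x → (p : Walk G y t) → x ∈ᵂ p

      Represents : Fin n → Fin n → Set
      Represents x y = y ∈ S × (y ≡ x ⊎ (y ∉ T × ShieldedBy x y))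

      ¬shielded-by-both : ∀ {x x′ y} → x ∈ T → x′ ∈ T → x ≢ x′ → ShieldedBy x y → ShieldedBy x′ y → ⊥
      ¬shielded-by-both {x} {x′} {y} x∈T x′∈T x≢x′ shielded shielded′ =
        ¬¬-geodesic (connected y x′) λ (g , geodesic) → shorter-than-geodesic g geodesic
        where
        shorter-than-geodesic : (g : Walk G y x′) → Geodesic G g → ⊥
        shorter-than-geodesic g geodesic with prefix g (shielded x′∈T (≢-sym x≢x′) g) x≢x′
        ... | q , q<g , _ with prefix q (shielded′ x∈T x≢x′ q) (≢-sym x≢x′)
        ... | q′ , q′<q , _ = <-irrefl refl (≤-<-trans (geodesic q′) (<-trans q′<q q<g))

      represents-injective : ∀ {x x′ y} → x ∈ T → x′ ∈ T → Represents x y → Represents x′ y → x ≡ x′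
      represents-injective {x} {x′} x∈T x′∈T (_ , rep) (_ , rep′) =
        decidable-stable (x ≟ x′) λ x≢x′ → distinct x≢x′ rep rep′
        where
        distinct : ∀ {y} → x ≢ x′ → y ≡ x ⊎ (y ∉ T × ShieldedBy x y) →
                   y ≡ x′ ⊎ (y ∉ T × ShieldedBy x′ y) → ⊥
        distinct x≢x′ (inj₁ refl)          (inj₁ refl)           = x≢x′ refl
        distinct _    (inj₁ refl)          (inj₂ (x∉T , _))      = x∉T x∈T
        distinct _    (inj₂ (x′∉T , _))    (inj₁ refl)           = x′∉T x′∈T
        distinct x≢x′ (inj₂ (_ , shielded)) (inj₂ (_ , shielded′)) =
          ¬shielded-by-both x∈T x′∈T x≢x′ shielded shielded′

      Escapes : Fin n → Fin n → Set
      Escapes x a = ∃ λ t → t ∈ T × t ≢ x × ∃ λ (p : Walk G a t) → x ∉ᵂ p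

      ¬both-escape : ∀ {x a b} → x ∈ T → Adj G x a → Adj G x b → a ≢ b → ¬ Adj G a b →
                     Escapes x a → Escapes x b → ⊥
      ¬both-escape {x} x∈T x~a x~b a≢b a≁b (t₁ , t₁∈T , t₁≢x , p₁ , x∉p₁) (t₂ , t₂∈T , t₂≢x , p₂ , x∉p₂)
        with t₁ ≟ t₂
      ... | yes refl = ∉-++ x∉p₁ (∉-reverse x∉p₂) (separates (p₁ ++ reverse p₂))
        where separates = common-neighbour-separates x~a x~b a≢b a≁b
      ... | no t₁≢t₂ = ¬¬-geodesic (connected t₁ t₂) λ (g , geodesic) → via g geodesic
        where
        via : (g : Walk G t₁ t₂) → Geodesic G g → ⊥
        via g geodesic with x ∈ᵂ? g
        ... | yes x∈g = T-gp x t₁ t₂ x∈T t₁∈T t₂∈T (≢-sym t₁≢x) t₁≢t₂ (≢-sym t₂≢x)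
                          (t₁ , t₂ , g , geodesic , x∈g , start∈ᵂ g , end∈ᵂ g)
        ... | no x∉g  = ∉-++ x∉p₁ (∉-++ x∉g (∉-reverse x∉p₂))
                          (common-neighbour-separates x~a x~b a≢b a≁b (p₁ ++ g ++ reverse p₂))

      module Farthest {x a} (x~a : Adj G x a) (¬escapes : ¬ Escapes x a)
                      (geodesic-from-x : ∀ v → ∃ λ (g : Walk G x v) → Geodesic G g) where

        dist : Fin n → ℕ
        dist v = length G (proj₁ (geodesic-from-x v))

        dist-≤ : ∀ {v} (q : Walk G x v) → dist v ≤ length G q
        dist-≤ {v} = proj₂ (geodesic-from-x v)

        Reachable : Fin n → Set
        Reachable v = ∃ λ (p : Walk G a v) → x ∉ᵂ p

        a-reachable : Reachable a
        a-reachable = here , λ { (here x≡a) → Adj⇒≢ x~a x≡a }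

        module _ {s} (s-reachable : Reachable s) (s-farthest : ∀ {v} → Reachable v → dist v ≤ dist s) where

          s≢x : s ≢ x
          s≢x refl = proj₂ s-reachable (end∈ᵂ (proj₁ s-reachable))

          neighbour-not-farther : ∀ {c} → Adj G s c → dist c ≤ dist s
          neighbour-not-farther {c} s~c with c ≟ x
          ... | yes refl = ≤-trans (dist-≤ here) z≤n
          ... | no c≢x   = s-farthest (proj₁ s-reachable ++ edge s~c ,
                             ∉-++ (proj₂ s-reachable) (λ x∈ → AllOn-edge {P = _≢ x} s~c s≢x c≢x x∈ refl))

          s∉geodesic : ∀ {c} → Adj G s c → s ∉ᵂ proj₁ (geodesic-from-x c)
          s∉geodesic {c} s~c s∈g with prefix (proj₁ (geodesic-from-x c)) s∈g (Adj⇒≢ s~c)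
          ... | q , q<g , _ = <-irrefl refl (≤-<-trans (dist-≤ q) (<-≤-trans q<g (neighbour-not-farther s~c)))

          simplicial : Simplicial G s
          simplicial c e s~c s~e c≢e = decidable-stable (adj c e Bool.≟ true) λ c≁e →
            ∉-++ (∉-reverse (s∉geodesic s~c)) (s∉geodesic s~e)
              (common-neighbour-separates s~c s~e c≢e c≁e
                 (reverse (proj₁ (geodesic-from-x c)) ++ proj₁ (geodesic-from-x e)))

          s∉T : s ∉ T
          s∉T s∈T = ¬escapes (s , s∈T , s≢x , s-reachable)

          shielded : ShieldedBy x s
          shielded {t} t∈T t≢x p with x ∈ᵂ? p
          ... | yes x∈p = x∈p
          ... | no x∉p  = ⊥-elim (¬escapes (t , t∈T , t≢x , proj₁ s-reachable ++ p , ∉-++ (proj₂ s-reachable) x∉p))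

        ¬¬-representative : ¬ ¬ ∃ (Represents x)
        ¬¬-representative = do
          s , s-reachable , s-farthest ← ¬¬-maximum Reachable dist (a , a-reachable)
          pure (s , simplicial⇒∈S (simplicial s-reachable s-farthest) ,
                inj₂ (s∉T s-reachable s-farthest , λ {t} → shielded s-reachable s-farthest {t}))

      ¬¬-representative : ∀ {x} → x ∈ T → ¬ ¬ ∃ (Represents x)
      ¬¬-representative {x} x∈T = do
        no ¬simplicial ← ¬¬-dec (Simplicial G x)
          where yes x-simplicial → pure (x , simplicial⇒∈S x-simplicial , inj₁ refl)
        a , b , x~a , x~b , a≢b , a≁b ← ¬¬-nonadjacent-neighbours ¬simplicial
        geodesic-from-x ← ¬¬-Π λ v → ¬¬-geodesic (connected x v)
        no ¬escapes-a ← ¬¬-dec (Escapes x a)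
          where yes escapes-a → Farthest.¬¬-representative x~b
                                  (¬both-escape x∈T x~a x~b a≢b a≁b escapes-a) geodesic-from-x
        Farthest.¬¬-representative x~a ¬escapes-a geodesic-from-x

      ∣T∣≤∣S∣ : ∣ T ∣ ≤ ∣ S ∣
      ∣T∣≤∣S∣ = decidable-stable (∣ T ∣ ≤? ∣ S ∣) do
        rep ← ¬¬-Π λ x → ¬¬-→ (¬¬-representative {x})
        pure (∣∣-mono-injection record
          { to        = λ {x} x∈T → proj₁ (rep x x∈T)
          ; to∈       = λ {x} x∈T → proj₁ (proj₂ (rep x x∈T))
          ; injective = λ {x} {y} x∈T y∈T x↦≡y↦ → represents-injective x∈T y∈T (proj₂ (rep x x∈T))
                          (subst (Represents y) (sym x↦≡y↦) (proj₂ (rep y y∈T)))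
          })

theorem3p6 : (n : ℕ) (G : Graph n) → Connected G → IsBlockGraph G →
    (S : Subset n) → (∀ v → (v ∈ S) ⇔ Simplicial G v) →
    IsGpSet G S × IsGpNumber G ∣ S ∣
theorem3p6 n G connected blockGraph S S⇔simplicial = (S-gp , S-maximum) , ((S , S-gp , refl) , S-maximum)
  where
  S-gp : IsGeneralPosition G S
  S-gp = simplicial-generalPosition G S (Equivalence.to (S⇔simplicial _))
  S-maximum : ∀ T → IsGeneralPosition G T → ∣ T ∣ ≤ ∣ S ∣
  S-maximum T T-gp =
    Representatives.∣T∣≤∣S∣ G blockGraph connected S (Equivalence.from (S⇔simplicial _)) T T-gp
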